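{- Let $X$ be a finite connected simplicial complex. If $\mathrm{diam}(X)\ge3$, then $\ddot{\mathrm{H}}^0(X)=0$.
   Context: $\mathrm{diam}(X)$ is the maximal graph distance between two vertices in the $1$-skeleton of $X$. $\mathbb{F}$ is the field with two elements. For $X$ with vertices $v_1,\dots,v_m$: a colouring $\varepsilon\in\mathbb{Z}_2^m$ colours $v_i$ black if $\varepsilon(i)=1$ and white otherwise; $|\varepsilon|$ is the number of black vertices; the weight of a simplex is its number of white vertices. The horizontal differential $\partial_h^\varepsilon$ on the simplicial chain complex $C(X)$ over $\mathbb{F}$ sends a simplex $\sigma$ to the sum of its faces $\sigma\setminus\{v\}$ over black $v\in\sigma$; $\mathrm{H}^h(X,\varepsilon)$ is its homology. For $\varepsilon,\varepsilon'$ differing only at index $i$ with $\varepsilon(i)=0,\varepsilon'(i)=1$, $d_{\varepsilon\to\varepsilon'}:\mathrm{H}^h(X,\varepsilon)\to\mathrm{H}^h(X,\varepsilon')$ sends the class of a cycle $x$ to the class of the sum of the simplices of $x$ not containing $v_i$. The \"uber complex is $\ddot{C}^j(X)=\bigoplus_{|\varepsilon|=j}\mathrm{H}^h(X,\varepsilon)$ with differential the sum of these maps; $\ddot{\mathrm{H}}^0(X)$ is its homology in homological degree $0$. -}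

module Defs where

open import Data.Nat using (ℕ; zero; suc; _≤_; _≡ᵇ_)
open import Data.Bool using (Bool; true; false; _∧_; not; _xor_; if_then_else_)
open import Data.Fin using (Fin; zero; suc)
open import Data.Fin.Subset using (Subset; _∈_; _∉_; _⊆_; _∪_; ⁅_⁆; ∣_∣; Nonempty)
open import Data.Vec using (lookup; _[_]≔_)
open import Data.Product using (Σ; ∃; _×_)
open import Relation.Binary.PropositionalEquality using (_≡_)
open import Relation.Nullary using (¬_)

record SimplicialComplex (m : ℕ) : Set where
  field
    simplex     : Subset m → Bool
    nonempty    : ∀ σ → simplex σ ≡ true → Nonempty σ
    downClosed  : ∀ σ τ → simplex σ ≡ true → τ ⊆ σ → Nonempty τ → simplex τ ≡ true
    vertices    : ∀ i → simplex ⁅ i ⁆ ≡ true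
open SimplicialComplex public

Adjacent : ∀ {m} → SimplicialComplex m → Fin m → Fin m → Set
Adjacent X u v = ¬ (u ≡ v) × simplex X (⁅ u ⁆ ∪ ⁅ v ⁆) ≡ true

data Walk {m} (X : SimplicialComplex m) : Fin m → Fin m → ℕ → Set where
  here : ∀ {u} → Walk X u u 0
  step : ∀ {u v w n} → Adjacent X u v → Walk X v w n → Walk X u w (suc n)

Connected : ∀ {m} → SimplicialComplex m → Set
Connected X = ∀ u v → ∃ λ n → Walk X u v n

DistAtLeast : ∀ {m} → SimplicialComplex m → Fin m → Fin m → ℕ → Set
DistAtLeast X u v k = ∀ n → Walk X u v n → k ≤ n

DiamAtLeast : ∀ {m} → SimplicialComplex m → ℕ → Set
DiamAtLeast X k = ∃ λ u → ∃ λ v → DistAtLeast X u v k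

-- Chains over 𝔽 = ℤ/2 (Bool with xor as addition)

xorSum : ∀ {n} → (Fin n → Bool) → Bool
xorSum {zero}  f = false
xorSum {suc n} f = f zero xor xorSum (λ i → f (suc i))

Chain : ℕ → Set
Chain m = Subset m → Bool

IsChain : ∀ {m} → SimplicialComplex m → Chain m → Set
IsChain X c = ∀ σ → c σ ≡ true → simplex X σ ≡ true

-- Colourings ε ∈ ℤ₂^m: vertex i is black iff i ∈ ε; |ε| = ∣ ε ∣.
Colouring : ℕ → Set
Colouring m = Subset m

-- Horizontal differential ∂ʰ_ε σ = Σ_{v ∈ σ black} σ ∖ {v}.
-- Coefficient at τ: sum over black v ∉ τ of c(τ ∪ {v}) (σ = τ ∪ {v});
-- empty faces are dropped (non-augmented chain complex).
∂h : ∀ {m} → Colouring m → Chain m → Chain m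
∂h ε c τ = if ∣ τ ∣ ≡ᵇ 0 then false
           else xorSum (λ v → lookup ε v ∧ (not (lookup τ v) ∧ c (τ ∪ ⁅ v ⁆)))

IsCycle : ∀ {m} → Colouring m → Chain m → Set
IsCycle ε x = ∀ τ → ∂h ε x τ ≡ false

IsBoundary : ∀ {m} → SimplicialComplex m → Colouring m → Chain m → Set
IsBoundary X ε x = Σ (Chain _) λ y → IsChain X y × (∀ τ → ∂h ε y τ ≡ x τ)

-- the chain-level map underlying d_{ε→ε'} (ε'(i)=1): drop simplices containing v_i
restrict : ∀ {m} → Fin m → Chain m → Chain m
restrict i x σ = x σ ∧ not (lookup σ i)

-- The uber complex. An element of C̈ʲ(X) = ⊕_{|ε|=j} Hʰ(X,ε) is represented
-- by a family of ε-cycles x ε (for |ε| = j); components with |ε| ≠ j are ignored.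

IsUberChain : ∀ {m} → SimplicialComplex m → ℕ → (Colouring m → Chain m) → Set
IsUberChain X j x = ∀ ε → ∣ ε ∣ ≡ j → IsChain X (x ε) × IsCycle ε (x ε)

UberZero : ∀ {m} → SimplicialComplex m → ℕ → (Colouring m → Chain m) → Set
UberZero X j x = ∀ ε → ∣ ε ∣ ≡ j → IsBoundary X ε (x ε)

-- uber differential: (d x)(ε') = Σ_{ε → ε'} d_{ε→ε'}(x ε),
-- the ε with ε → ε' being ε'[i ↦ 0] for i with ε'(i) = 1
uberD : ∀ {m} → (Colouring m → Chain m) → Colouring m → Chain m
uberD x ε' σ = xorSum (λ i → lookup ε' i ∧ restrict i (x (ε' [ i ]≔ false)) σ)

-- Ḧ⁰(X) = 0 : C̈⁻¹ = 0, so this says every degree-0 uber cycle is zero.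
UberH0Vanishes : ∀ {m} → SimplicialComplex m → Set
UberH0Vanishes X = ∀ x → IsUberChain X 0 x → UberZero X 1 (uberD x) → UberZero X 0 x

-- For the colouring ∅ every vertex is white, so ∂ʰ vanishes and Hʰ(X,∅) = C(X): a degree-0 uber
-- cycle is just a chain x, and it is zero in Ḧ⁰ iff x = 0.  Suppose τ lies in the support
-- of x.  For a vertex a ∉ τ the {a}-component of d x is x with the simplices through a
-- dropped, so it still has coefficient 1 at τ; since ∂ʰ_{a} only removes a, that coefficient
-- can only come from the face τ of τ ∪ {a}, which must therefore be a simplex.  Hence every
-- vertex of τ is adjacent to every other vertex and diam(X) ≤ 2.
module Submission where

open import Defs
open import Data.Nat using (ℕ; zero; suc; _+_; _≤_; _≡ᵇ_; s≤s; z≤n)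
open import Data.Nat.Properties using (+-mono-≤; ≤-trans)
open import Data.Bool using (Bool; true; false; _∧_; not; _xor_; if_then_else_)
open import Data.Bool.Properties using (∧-zeroʳ; ∧-conicalʳ; xor-identityʳ)
open import Data.Fin using (Fin; zero; suc; _≟_)
open import Data.Fin.Subset using (Subset; _∈_; _⊆_; _∪_; ⁅_⁆; ∣_∣; ⊥; outside)
open import Data.Fin.Subset.Properties using (x∈⁅x⁆; x∈⁅y⁆⇒x≡y; x∈p∪q⁻; x∈p∪q⁺; ∣⁅x⁆∣≡1; ∣⊥∣≡0; ∪-comm)
open import Data.Vec using ([]; _∷_; lookup; _[_]≔_)
open import Data.Vec.Properties using (lookup⇒[]=; lookup-replicate)
open import Data.Product using (∃; _×_; _,_; proj₁)
open import Data.Sum using (inj₁; inj₂)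
open import Data.Empty using (⊥-elim)
open import Relation.Binary.PropositionalEquality
open import Relation.Nullary using (¬_; yes; no)

xorSum-zero : ∀ {n} (f : Fin n → Bool) → (∀ i → f i ≡ false) → xorSum f ≡ false
xorSum-zero {zero}  f f≡0 = refl
xorSum-zero {suc n} f f≡0 rewrite f≡0 zero = xorSum-zero (λ i → f (suc i)) (λ i → f≡0 (suc i))

xorSum-⁅⁆ : ∀ {n} (a : Fin n) (f : Fin n → Bool) → xorSum (λ i → lookup ⁅ a ⁆ i ∧ f i) ≡ f a
xorSum-⁅⁆ zero f = begin
  f zero xor xorSum (λ i → lookup ⊥ i ∧ f (suc i)) ≡⟨ cong (f zero xor_) (xorSum-zero _ lookup⊥) ⟩
  f zero xor false                                  ≡⟨ xor-identityʳ (f zero) ⟩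
  f zero                                            ∎
  where
  open ≡-Reasoning
  lookup⊥ : ∀ i → lookup ⊥ i ∧ f (suc i) ≡ false
  lookup⊥ i rewrite lookup-replicate i outside = refl
xorSum-⁅⁆ (suc a) f = xorSum-⁅⁆ a (λ i → f (suc i))

∣p∣≡0⇒p≡⊥ : ∀ {n} (p : Subset n) → ∣ p ∣ ≡ 0 → p ≡ ⊥
∣p∣≡0⇒p≡⊥ []           _     = refl
∣p∣≡0⇒p≡⊥ (true ∷ p)   ()
∣p∣≡0⇒p≡⊥ (false ∷ p)  ∣p∣≡0 = cong (false ∷_) (∣p∣≡0⇒p≡⊥ p ∣p∣≡0)

⁅x⁆[x]≔outside≡⊥ : ∀ {n} (x : Fin n) → ⁅ x ⁆ [ x ]≔ outside ≡ ⊥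
⁅x⁆[x]≔outside≡⊥ zero    = refl
⁅x⁆[x]≔outside≡⊥ (suc x) = cong (false ∷_) (⁅x⁆[x]≔outside≡⊥ x)

∂h-zero : ∀ {m} (ε : Colouring m) τ → ∂h ε (λ _ → false) τ ≡ false
∂h-zero ε τ with ∣ τ ∣ ≡ᵇ 0
... | true  = refl
... | false = xorSum-zero _ λ v →
  trans (cong (lookup ε v ∧_) (∧-zeroʳ (not (lookup τ v)))) (∧-zeroʳ (lookup ε v))

∂h-⁅⁆ : ∀ {m} (a : Fin m) (y : Chain m) τ →
        ∂h ⁅ a ⁆ y τ ≡ (if ∣ τ ∣ ≡ᵇ 0 then false else (not (lookup τ a) ∧ y (τ ∪ ⁅ a ⁆)))
∂h-⁅⁆ a y τ = cong (if ∣ τ ∣ ≡ᵇ 0 then false else_) (xorSum-⁅⁆ a _)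

∂h-⁅⁆-true : ∀ {m} (a : Fin m) (y : Chain m) τ → ∂h ⁅ a ⁆ y τ ≡ true → y (τ ∪ ⁅ a ⁆) ≡ true
∂h-⁅⁆-true a y τ ∂y≡1 with ∣ τ ∣ ≡ᵇ 0 | trans (sym (∂h-⁅⁆ a y τ)) ∂y≡1
... | false | coeff≡1 = ∧-conicalʳ _ _ coeff≡1

uberD-⁅⁆ : ∀ {m} (x : Colouring m → Chain m) (a : Fin m) σ → uberD x ⁅ a ⁆ σ ≡ restrict a (x ⊥) σ
uberD-⁅⁆ x a σ = trans (xorSum-⁅⁆ a (λ i → restrict i (x (⁅ a ⁆ [ i ]≔ false)) σ))
                       (cong (λ ε → restrict a (x ε) σ) (⁅x⁆[x]≔outside≡⊥ a))

vanishing⇒IsBoundary : ∀ {m} (X : SimplicialComplex m) ε (x : Chain m) →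
                       (∀ τ → x τ ≡ false) → IsBoundary X ε x
vanishing⇒IsBoundary X ε x x≡0 = (λ _ → false) , (λ _ ()) , λ τ → trans (∂h-zero ε τ) (sym (x≡0 τ))

_++ʷ_ : ∀ {m} {X : SimplicialComplex m} {u v w k l} → Walk X u v k → Walk X v w l → Walk X u w (k + l)
here       ++ʷ q = q
step uv p  ++ʷ q = step uv (p ++ʷ q)

module _ {m} (X : SimplicialComplex m) where

  edge-face : ∀ {σ a b} → simplex X σ ≡ true → a ∈ σ → b ∈ σ → simplex X (⁅ a ⁆ ∪ ⁅ b ⁆) ≡ true
  edge-face {σ} {a} {b} σ∈X a∈σ b∈σ = downClosed X σ _ σ∈X ab⊆σ (a , x∈p∪q⁺ (inj₁ (x∈⁅x⁆ a)))
    where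
    ab⊆σ : ⁅ a ⁆ ∪ ⁅ b ⁆ ⊆ σ
    ab⊆σ x∈ab with x∈p∪q⁻ ⁅ a ⁆ ⁅ b ⁆ x∈ab
    ... | inj₁ x∈⁅a⁆ rewrite x∈⁅y⁆⇒x≡y a x∈⁅a⁆ = a∈σ
    ... | inj₂ x∈⁅b⁆ rewrite x∈⁅y⁆⇒x≡y b x∈⁅b⁆ = b∈σ

  DominatingVertex : Fin m → Set
  DominatingVertex w = ∀ a → simplex X (⁅ w ⁆ ∪ ⁅ a ⁆) ≡ true

  module _ {w : Fin m} (dom : DominatingVertex w) where

    walk-from : ∀ v → ∃ λ n → n ≤ 1 × Walk X w v n
    walk-from v with w ≟ v
    ... | yes refl = 0 , z≤n , here
    ... | no w≢v   = 1 , s≤s z≤n , step (w≢v , dom v) here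

    walk-to : ∀ u → ∃ λ n → n ≤ 1 × Walk X u w n
    walk-to u with u ≟ w
    ... | yes refl = 0 , z≤n , here
    ... | no u≢w   = 1 , s≤s z≤n , step (u≢w , uw∈X) here
      where
      uw∈X : simplex X (⁅ u ⁆ ∪ ⁅ w ⁆) ≡ true
      uw∈X = subst (λ σ → simplex X σ ≡ true) (∪-comm ⁅ w ⁆ ⁅ u ⁆) (dom u)

    dominatingVertex⇒¬DiamAtLeast3 : ¬ DiamAtLeast X 3
    dominatingVertex⇒¬DiamAtLeast3 (u , v , dist≥3)
      with walk-to u | walk-from v
    ... | k , k≤1 , p | l , l≤1 , q = 3≰2 (≤-trans (dist≥3 (k + l) (p ++ʷ q)) (+-mono-≤ k≤1 l≤1))
      where
      3≰2 : ¬ 3 ≤ 2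
      3≰2 (s≤s (s≤s ()))

  module _ (x : Colouring m → Chain m) (dx≈0 : UberZero X 1 (uberD x)) where

    support-extends : ∀ {τ} a → x ⊥ τ ≡ true → lookup τ a ≡ false → simplex X (τ ∪ ⁅ a ⁆) ≡ true
    support-extends {τ} a xτ≡1 a∉τ with dx≈0 ⁅ a ⁆ (∣⁅x⁆∣≡1 a)
    ... | y , y∈X , ∂y≡dx = y∈X _ (∂h-⁅⁆-true a y τ ∂y≡1)
      where
      ∂y≡1 : ∂h ⁅ a ⁆ y τ ≡ true
      ∂y≡1 = begin
        ∂h ⁅ a ⁆ y τ                  ≡⟨ ∂y≡dx τ ⟩
        uberD x ⁅ a ⁆ τ               ≡⟨ uberD-⁅⁆ x a τ ⟩
        x ⊥ τ ∧ not (lookup τ a)      ≡⟨ cong₂ (λ b c → b ∧ not c) xτ≡1 a∉τ ⟩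
        true                          ∎
        where open ≡-Reasoning

    support-dominating : ∀ {τ w} → simplex X τ ≡ true → x ⊥ τ ≡ true → w ∈ τ → DominatingVertex w
    support-dominating {τ} {w} τ∈X xτ≡1 w∈τ a with lookup τ a in τ[a]
    ... | true  = edge-face τ∈X w∈τ (lookup⇒[]= a τ τ[a])
    ... | false = edge-face (support-extends a xτ≡1 τ[a])
                            (x∈p∪q⁺ (inj₁ w∈τ)) (x∈p∪q⁺ {p = τ} (inj₂ (x∈⁅x⁆ a)))

    support-empty : DiamAtLeast X 3 → IsChain X (x ⊥) → ∀ τ → x ⊥ τ ≡ false
    support-empty diam≥3 x⊥∈X τ with x ⊥ τ in xτ≡1
    ... | false = refl
    ... | true with nonempty X τ (x⊥∈X τ xτ≡1)
    ...   | w , w∈τ = ⊥-elim (dominatingVertex⇒¬DiamAtLeast3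
                                (support-dominating (x⊥∈X τ xτ≡1) xτ≡1 w∈τ) diam≥3)

corollary7p4 : ∀ {m : ℕ} (X : SimplicialComplex m) → Connected X → DiamAtLeast X 3 → UberH0Vanishes X
corollary7p4 {m} X _ diam≥3 x x-cycle dx≈0 ε ∣ε∣≡0 rewrite ∣p∣≡0⇒p≡⊥ ε ∣ε∣≡0 =
  vanishing⇒IsBoundary X ⊥ (x ⊥) (support-empty X x dx≈0 diam≥3 x⊥∈X)
  where
  x⊥∈X : IsChain X (x ⊥)
  x⊥∈X = proj₁ (x-cycle ⊥ (∣⊥∣≡0 m))
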